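{- Let $(L;\wedge,\vee,^{\Delta},^{\nabla},0,1)$ be a weakly dicomplemented lattice and let $F(L)$ be the set of filters of $L$. For $F\in F(L)$ put $F^{\star}=\{a\in L\mid x^{\Delta}\le a\text{ for all } x\in F\}$. Then $(F(L);\cap,\vee,^{\star},\{1\},L)$ is a dual weakly complemented lattice, where $\vee$ denotes the join of filters (the smallest filter containing both). That is, $F^{\star}\in F(L)$ for every $F\in F(L)$, and for all $F,G\in F(L)$: $F\subseteq F^{\star\star}$; $F\subseteq G$ implies $G^{\star}\subseteq F^{\star}$; and $(F\vee G)\cap(F\vee G^{\star})=F$.
   Context: A weakly dicomplemented lattice (WDL) is an algebra $(L;\wedge,\vee,^{\Delta},^{\nabla},0,1)$ such that $(L;\wedge,\vee,0,1)$ is a bounded lattice and, for all $x,y\in L$: $x^{\Delta\Delta}\le x$; $x\le y\Rightarrow y^{\Delta}\le x^{\Delta}$; $(x\wedge y)\vee(x\wedge y^{\Delta})=x$; $x^{\nabla\nabla}\ge x$; $x\le y\Rightarrow y^{\nabla}\le x^{\nabla}$; $(x\vee y)\wedge(x\vee y^{\nabla})=x$. A dual weakly complemented lattice is a bounded lattice $(M;\wedge,\vee,0,1)$ with a unary operation $^{\nabla}$ satisfying the last three of these axioms. A filter of $L$ is a nonempty upward closed subset closed under $\wedge$; $F(L)$ is ordered by inclusion, with least element $\{1\}$ and greatest element $L$. -}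

module Defs where

open import Level using (Level; suc; _⊔_; Lift)
open import Algebra.Lattice.Bundles using (Lattice)
open import Data.Product using (Σ; ∃; _×_; _,_)
open import Relation.Unary using (Pred; _⊆_; _∩_)

record WDL (c ℓ : Level) : Set (suc (c ⊔ ℓ)) where
  field
    lattice : Lattice c ℓ
  open Lattice lattice public
  _≤_ : Carrier → Carrier → Set ℓ
  x ≤ y = (x ∧ y) ≈ x
  field
    0# 1# : Carrier
    0-least : ∀ x → 0# ≤ x
    1-greatest : ∀ x → x ≤ 1#
    Δ ∇ : Carrier → Carrier
    ΔΔ-≤ : ∀ x → Δ (Δ x) ≤ x
    Δ-antitone : ∀ x y → x ≤ y → Δ y ≤ Δ x
    Δ-law : ∀ x y → ((x ∧ y) ∨ (x ∧ Δ y)) ≈ x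
    ∇∇-≥ : ∀ x → x ≤ ∇ (∇ x)
    ∇-antitone : ∀ x y → x ≤ y → ∇ y ≤ ∇ x
    ∇-law : ∀ x y → ((x ∨ y) ∧ (x ∨ ∇ y)) ≈ x

module FilterDefs {c ℓ : Level} (W : WDL c ℓ) where
  open WDL W

  -- subsets of L (at a fixed level so that the operations below stay in it)
  Subset : Set (suc (c ⊔ ℓ))
  Subset = Pred Carrier (c ⊔ ℓ)

  record IsFilter (F : Subset) : Set (c ⊔ ℓ) where
    field
      nonempty : ∃ λ x → F x
      up-closed : ∀ {x y} → F x → x ≤ y → F y
      ∧-closed : ∀ {x y} → F x → F y → F (x ∧ y)

  _≐_ : Subset → Subset → Set (c ⊔ ℓ)
  F ≐ G = (F ⊆ G) × (G ⊆ F)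

  one : Subset
  one a = Lift (c ⊔ ℓ) (a ≈ 1#)

  whole : Subset
  whole a = Lift (c ⊔ ℓ) (a ≈ a)

  _⋆ : Subset → Subset
  (F ⋆) a = ∀ x → F x → Δ x ≤ a

  -- join of filters, constructed as { a | f ∧ g ≤ a for some f ∈ F, g ∈ G };
  -- the theorem also asserts it is the smallest filter containing F and G.
  _⊻_ : Subset → Subset → Subset
  (F ⊻ G) a = ∃ λ f → ∃ λ g → F f × G g × ((f ∧ g) ≤ a)

-- As the set of common upper
-- bounds of { Δ x | x ∈ F }, F⋆ is a filter for any F; F ⊆ F⋆⋆ and antitonicity
-- of ⋆ come from Δ Δ x ≤ x and antitonicity of Δ.  The identity
-- (F ⊻ G) ∩ (F ⊻ G⋆) = F is the filter form of the Δ-law x = (x ∧ y) ∨ (x ∧ Δ y).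
module Submission where

open import Defs
open import Level using (Level; lift; lower)
open import Data.Product using (_×_; _,_)
open import Relation.Unary using (_⊆_; _∩_)
open import Algebra.Lattice.Bundles using (Lattice)
open import Algebra.Lattice.Properties.Lattice using (∨-∧-orderTheoreticLattice)
import Relation.Binary.Lattice as OrderLattice
import Relation.Binary.Lattice.Properties.MeetSemilattice as MeetSemilatticeProperties

-- The standard library orders a lattice by x ≈ x ∧ y; the definitions here use
-- x ∧ y ≈ x, so each order fact is transported along sym.
module MeetOrder {c ℓ : Level} (L : Lattice c ℓ) where
  open Lattice L

  _≤_ : Carrier → Carrier → Set ℓ
  x ≤ y = (x ∧ y) ≈ x

  private
    module O = OrderLattice.Lattice (∨-∧-orderTheoreticLattice L)
    open MeetSemilatticeProperties O.meetSemilattice using (∧-monotonic)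

  ≤-refl : ∀ {x} → x ≤ x
  ≤-refl = sym O.refl

  ≤-reflexive : ∀ {x y} → x ≈ y → x ≤ y
  ≤-reflexive x≈y = sym (O.reflexive x≈y)

  ≤-trans : ∀ {x y z} → x ≤ y → y ≤ z → x ≤ z
  ≤-trans x≤y y≤z = sym (O.trans (sym x≤y) (sym y≤z))

  ≤-antisym : ∀ {x y} → x ≤ y → y ≤ x → x ≈ y
  ≤-antisym x≤y y≤x = O.antisym (sym x≤y) (sym y≤x)

  x∧y≤x : ∀ x y → (x ∧ y) ≤ x
  x∧y≤x x y = sym (O.x∧y≤x x y)

  x∧y≤y : ∀ x y → (x ∧ y) ≤ y
  x∧y≤y x y = sym (O.x∧y≤y x y)

  ∧-greatest : ∀ {x y z} → x ≤ y → x ≤ z → x ≤ (y ∧ z)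
  ∧-greatest x≤y x≤z = sym (O.∧-greatest (sym x≤y) (sym x≤z))

  ∨-least : ∀ {x y z} → x ≤ z → y ≤ z → (x ∨ y) ≤ z
  ∨-least x≤z y≤z = sym (O.∨-least (sym x≤z) (sym y≤z))

  ∧-mono-≤ : ∀ {x y u v} → x ≤ y → u ≤ v → (x ∧ u) ≤ (y ∧ v)
  ∧-mono-≤ x≤y u≤v = sym (∧-monotonic (sym x≤y) (sym u≤v))

module FilterLattice {c ℓ : Level} (W : WDL c ℓ) where
  open WDL W
  open FilterDefs W
  open MeetOrder lattice hiding (_≤_)
  open IsFilter

  one-isFilter : IsFilter one
  one-isFilter = record
    { nonempty  = 1# , lift refl
    ; up-closed = λ {x} {y} x≈1 x≤y →
        lift (≤-antisym (1-greatest y) (≤-trans (≤-reflexive (sym (lower x≈1))) x≤y))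
    ; ∧-closed  = λ {x} {y} x≈1 y≈1 →
        lift (≤-antisym (1-greatest (x ∧ y))
          (∧-greatest (≤-reflexive (sym (lower x≈1))) (≤-reflexive (sym (lower y≈1)))))
    }

  whole-isFilter : IsFilter whole
  whole-isFilter = record
    { nonempty  = 1# , lift refl
    ; up-closed = λ _ _ → lift refl
    ; ∧-closed  = λ _ _ → lift refl
    }

  one⊆filter : ∀ {F} → IsFilter F → one ⊆ F
  one⊆filter isF {a} a≈1 with nonempty isF
  ... | x , Fx = up-closed isF (up-closed isF Fx (1-greatest x)) (≤-reflexive (sym (lower a≈1)))

  ⊆-whole : (F : Subset) → F ⊆ whole
  ⊆-whole _ _ = lift refl

  ∩-isFilter : ∀ {F G} → IsFilter F → IsFilter G → IsFilter (F ∩ G)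
  ∩-isFilter isF isG = record
    { nonempty  = 1# , one⊆filter isF (lift refl) , one⊆filter isG (lift refl)
    ; up-closed = λ (Fx , Gx) x≤y → up-closed isF Fx x≤y , up-closed isG Gx x≤y
    ; ∧-closed  = λ (Fx , Gx) (Fy , Gy) → ∧-closed isF Fx Fy , ∧-closed isG Gx Gy
    }

  ⊻-isFilter : ∀ {F G} → IsFilter F → IsFilter G → IsFilter (F ⊻ G)
  ⊻-isFilter isF isG with nonempty isF | nonempty isG
  ... | f , Ff | g , Gg = record
    { nonempty  = f ∧ g , f , g , Ff , Gg , ≤-refl
    ; up-closed = λ (f , g , Ff , Gg , f∧g≤x) x≤y → f , g , Ff , Gg , ≤-trans f∧g≤x x≤y
    ; ∧-closed  = λ (f₁ , g₁ , Ff₁ , Gg₁ , ≤x) (f₂ , g₂ , Ff₂ , Gg₂ , ≤y) →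
        f₁ ∧ f₂ , g₁ ∧ g₂ , ∧-closed isF Ff₁ Ff₂ , ∧-closed isG Gg₁ Gg₂ ,
        ∧-greatest (≤-trans (∧-mono-≤ (x∧y≤x f₁ f₂) (x∧y≤x g₁ g₂)) ≤x)
                   (≤-trans (∧-mono-≤ (x∧y≤y f₁ f₂) (x∧y≤y g₁ g₂)) ≤y)
    }

  ⊆-⊻ˡ : ∀ F {G} → IsFilter G → F ⊆ (F ⊻ G)
  ⊆-⊻ˡ F isG {a} Fa with nonempty isG
  ... | g , Gg = a , g , Fa , Gg , x∧y≤x a g

  ⊆-⊻ʳ : ∀ {F} G → IsFilter F → G ⊆ (F ⊻ G)
  ⊆-⊻ʳ G isF {a} Ga with nonempty isF
  ... | f , Ff = f , a , Ff , Ga , x∧y≤y f a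

  ⊻-least : ∀ {F G H} → IsFilter H → F ⊆ H → G ⊆ H → (F ⊻ G) ⊆ H
  ⊻-least isH F⊆H G⊆H (f , g , Ff , Gg , f∧g≤a) =
    up-closed isH (∧-closed isH (F⊆H Ff) (G⊆H Gg)) f∧g≤a

  ⋆-isFilter : ∀ F → IsFilter (F ⋆)
  ⋆-isFilter F = record
    { nonempty  = 1# , λ x _ → 1-greatest (Δ x)
    ; up-closed = λ Δ≤x x≤y z Fz → ≤-trans (Δ≤x z Fz) x≤y
    ; ∧-closed  = λ Δ≤x Δ≤y z Fz → ∧-greatest (Δ≤x z Fz) (Δ≤y z Fz)
    }

  ⊆-⋆⋆ : ∀ F → F ⊆ ((F ⋆) ⋆)
  ⊆-⋆⋆ F {a} Fa y Δ≤y = ≤-trans (Δ-antitone (Δ a) y (Δ≤y a Fa)) (ΔΔ-≤ a)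

  ⋆-antitone : ∀ {F G} → F ⊆ G → (G ⋆) ⊆ (F ⋆)
  ⋆-antitone F⊆G Δ≤a x Fx = Δ≤a x (F⊆G Fx)

  -- For f = f₁ ∧ f₂, the Δ-law writes f as (f ∧ g) ∨ (f ∧ Δ g), and Δ g ≤ h.
  ⊻∩⊻⋆⊆ : ∀ {F} G → IsFilter F → ((F ⊻ G) ∩ (F ⊻ (G ⋆))) ⊆ F
  ⊻∩⊻⋆⊆ G isF ((f₁ , g , Ff₁ , Gg , f₁∧g≤a) , (f₂ , h , Ff₂ , Δ≤h , f₂∧h≤a)) =
    up-closed isF (∧-closed isF Ff₁ Ff₂)
      (≤-trans (≤-reflexive (sym (Δ-law (f₁ ∧ f₂) g)))
        (∨-least (≤-trans (∧-mono-≤ (x∧y≤x f₁ f₂) ≤-refl) f₁∧g≤a)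
                 (≤-trans (∧-mono-≤ (x∧y≤y f₁ f₂) (Δ≤h g Gg)) f₂∧h≤a)))

  ⊻∩⊻⋆≐ : ∀ {F G} → IsFilter F → IsFilter G → ((F ⊻ G) ∩ (F ⊻ (G ⋆))) ≐ F
  ⊻∩⊻⋆≐ {F} {G} isF isG =
    ⊻∩⊻⋆⊆ G isF , λ Fa → ⊆-⊻ˡ F isG Fa , ⊆-⊻ˡ F (⋆-isFilter G) Fa

theorem3p3 : {c ℓ : Level} (W : WDL c ℓ) →
    let open FilterDefs W in
    -- F(L) with ∩, ⊻, {1}, L is a bounded lattice of filters
    (IsFilter one × IsFilter whole
      × (∀ F → IsFilter F → (one ⊆ F) × (F ⊆ whole))
      × (∀ F G → IsFilter F → IsFilter G → IsFilter (F ∩ G))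
      × (∀ F G → IsFilter F → IsFilter G →
           IsFilter (F ⊻ G) × (F ⊆ (F ⊻ G)) × (G ⊆ (F ⊻ G))
           × (∀ H → IsFilter H → F ⊆ H → G ⊆ H → (F ⊻ G) ⊆ H)))
    -- ⋆ is a dual weak complementation on F(L)
    × (∀ F → IsFilter F → IsFilter (F ⋆))
    × (∀ F → IsFilter F → F ⊆ ((F ⋆) ⋆))
    × (∀ F G → IsFilter F → IsFilter G → F ⊆ G → (G ⋆) ⊆ (F ⋆))
    × (∀ F G → IsFilter F → IsFilter G → ((F ⊻ G) ∩ (F ⊻ (G ⋆))) ≐ F)
theorem3p3 W =
  ( one-isFilter
  , whole-isFilter
  , (λ F isF → one⊆filter isF , ⊆-whole F)
  , (λ _ _ → ∩-isFilter)
  , (λ F G isF isG →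
       ⊻-isFilter isF isG , ⊆-⊻ˡ F isG , ⊆-⊻ʳ G isF , λ _ isH → ⊻-least isH) )
  , (λ F _ → ⋆-isFilter F)
  , (λ F _ → ⊆-⋆⋆ F)
  , (λ _ _ _ _ → ⋆-antitone)
  , (λ _ _ → ⊻∩⊻⋆≐)
  where open FilterLattice W
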